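{- Let $\mathcal{F}_n$ be the set of words encoding the states of the $n$-foil $F_n$ with exactly two components. Then $\mathcal{F}_0=\{\varepsilon\}$, $\mathcal{F}_1=\{1\}$ and $\mathcal{F}_n=0\mathcal{T}_{n-1}\cup 1\mathcal{F}_{n-1}$ for $n\geq 2$. Moreover, for $n\geq 2$, \[ \mathcal{F}_n=\{1^p\,0\,1^k\,0\,1^{\,n-p-k-2} : 0\leq p\leq n-2,\ 0\leq k\leq n-p-2\}\cup\{1^n\}. \]
   Context: Splitting a crossing of a plane curve means deleting a small neighbourhood of it and reconnecting the four loose ends by two disjoint arcs; a state is obtained by splitting every crossing and is a disjoint union of simple closed curves. A state is encoded by the word $\sigma_1\cdots\sigma_n$ with $\sigma_i=0$ if the $A$-split was applied at the $i$-th crossing and $\sigma_i=1$ for the $B$-split; $\varepsilon$ is the empty word, $w^k$ is $k$ concatenated copies of $w$, and $aX=\{aw:w\in X\}$. For $n\ge0$ let $R_n$ be a horizontal twist region: two strands running left to right crossing each other $n$ times consecutively at $c_1,\dots,c_n$ (for $n=0$ two parallel segments), with ends NW, SW (left) and NE, SE (right). The $n$-foil $F_n$ is obtained by joining NW to NE by an arc above $R_n$ and SW to SE by an arc below $R_n$ (standard $(2,n)$-torus shadow; $F_0$ is two disjoint circles, with unique state encoded by $\varepsilon$). Each crossing has a top, bottom, left and right corner; the region above $R_n$ (bounded by the upper arc) contains the top corner of every crossing and the region below $R_n$ contains the bottom corner of every crossing; these two regions are the $A$-regions (the shadow being viewed on the sphere so that one of them is the unbounded region), and the remaining regions are $B$-regions.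 Thus the $A$-split at $c_i$ merges its top and bottom corners and the $B$-split merges its left and right corners. The $n$-twist loop $T_n$ is obtained from $R_n$ by joining NW to SW on the left and NE to SE on the right; its crossings $c_1,\dots,c_n$ are ordered left to right, its $A$-split at a crossing merges the two corners lying in the unbounded region and the $B$-split merges the two corners lying in the lobes to the left and right. $\mathcal{T}_m$ is the set of words encoding the states of $T_m$ with exactly two components. -}

module Defs where

open import Data.Nat using (ℕ; zero; suc)
open import Data.Fin using (Fin; zero; suc; fromℕ)
open import Data.Bool using (Bool; true; false)
open import Data.List using (List; []; _∷_; _++_; map; length)
open import Data.Product using (_×_; _,_; ∃; ∃-syntax)
open import Data.Sum using (_⊎_)
open import Data.List.Membership.Propositional using (_∈_)
open import Relation.Nullary using (¬_)
open import Relation.Binary.PropositionalEquality using (_≡_)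
open import Relation.Binary.Construct.Closure.Equivalence using (EqClosure)

-- A split at a crossing.  Letter 0 of the paper = A, letter 1 = B.
data Split : Set where
  A B : Split

Word : Set
Word = List Split

-- The strands of R_n are cut by the crossings c₁,…,cₙ into segments:
-- top segments (seg i , true) and bottom segments (seg i , false) for
-- i = 0,…,n; segment i lies between c_i and c_{i+1} (segment 0 is left of
-- c₁ and ends at NW / SW, segment n is right of cₙ and ends at NE / SE).
-- At crossing c_{i+1} the corner ends are NW = (i,top), SW = (i,bot),
-- NE = (i+1,top), SE = (i+1,bot).
Seg : ℕ → Set
Seg n = Fin (suc n) × Bool

top bot : Bool
top = true
bot = false

-- A-split merges top and bottom corners: arcs NW–SW and NE–SE.
-- B-split merges left and right corners: arcs NW–NE and SW–SE.
splitArcs : {m : ℕ} → Split → Fin m → Fin m → List (Fin m × Bool × Fin m × Bool)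
splitArcs A l r = (l , top , l , bot) ∷ (r , top , r , bot) ∷ []
splitArcs B l r = (l , top , r , top) ∷ (l , bot , r , bot) ∷ []

liftArc : {m : ℕ} → Fin m × Bool × Fin m × Bool → Fin (suc m) × Bool × Fin (suc m) × Bool
liftArc (i , s , j , t) = (suc i , s , suc j , t)

twistArcs : (w : Word) → List (Fin (suc (length w)) × Bool × Fin (suc (length w)) × Bool)
twistArcs [] = []
twistArcs (s ∷ w) = splitArcs s zero (suc zero) ++ map liftArc (twistArcs w)

-- Closures.  n-foil: NW–NE joined above, SW–SE joined below.
foilArcs : (w : Word) → List (Fin (suc (length w)) × Bool × Fin (suc (length w)) × Bool)
foilArcs w = (zero , top , fromℕ (length w) , top)
           ∷ (zero , bot , fromℕ (length w) , bot) ∷ twistArcs w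

-- n-twist loop: NW–SW joined on the left, NE–SE joined on the right.
loopArcs : (w : Word) → List (Fin (suc (length w)) × Bool × Fin (suc (length w)) × Bool)
loopArcs w = (zero , top , zero , bot)
           ∷ (fromℕ (length w) , top , fromℕ (length w) , bot) ∷ twistArcs w

Joined : {m : ℕ} → List (Fin m × Bool × Fin m × Bool) → Fin m × Bool → Fin m × Bool → Set
Joined arcs (i , s) (j , t) = (i , s , j , t) ∈ arcs

SameComponent : {m : ℕ} → List (Fin m × Bool × Fin m × Bool) → Fin m × Bool → Fin m × Bool → Set
SameComponent arcs = EqClosure (Joined arcs)

TwoComponents : {m : ℕ} → List (Fin m × Bool × Fin m × Bool) → Set
TwoComponents {m} arcs =
  ∃[ u ] ∃[ v ] (¬ SameComponent arcs u v × (∀ x → SameComponent arcs x u ⊎ SameComponent arcs x v))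

𝓕 : ℕ → Word → Set
𝓕 n w = length w ≡ n × TwoComponents (foilArcs w)

𝓣 : ℕ → Word → Set
𝓣 n w = length w ≡ n × TwoComponents (loopArcs w)

_^_ : Split → ℕ → Word
s ^ zero = []
s ^ suc k = s ∷ (s ^ k)

module Submission where

-- Cut the strands of the twist region R_n at its crossings into
-- segments; the *level* of the segment between c_i and c_{i+1} is the number of
-- A-splits among c₁,…,c_i.  Arcs of a state never change the level, and inside
-- R_n segments on the same side with equal level are joined, while at every
-- level ≥ 1 the two sides are joined by the A-split creating that level.
-- With a the number of A-splits of w:
--   * the loop closure joins the sides at levels 0 and a, so T_n has one
--     component per level, and two iff a = 1;
--   * the foil closure identifies levels 0 and a (levels are invariant modulo
--     a), so for a ≥ 1 F_n has a components, and for a = 0 it has two (the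
--     sides, kept apart by B-splits); it has two iff a ∈ {0, 2}.
-- The theorem then reduces to counting A-letters: words with no A are B^n,
-- words with two are B^p A B^k A B^r, and prefixing A raises the count by one.

open import Defs
open import Data.Nat using (ℕ; _≤_; _∸_)
open import Data.List using (List; []; _∷_; _++_)
open import Data.Product using (_×_; ∃-syntax)
open import Data.Sum using (_⊎_)
open import Function.Bundles using (_⇔_)
open import Relation.Binary.PropositionalEquality using (_≡_)

open import Data.Nat using (zero; suc; _+_; z≤n; s≤s)
open import Data.Nat.Properties using (+-assoc; suc-injective; n≤0⇒n≡0; +-suc; m≤m+n; m+[n∸m]≡n; +-∸-assoc)
open import Data.Nat.DivMod using (_%_; n%n≡0)
open import Data.Fin using (Fin; zero; suc; fromℕ)
open import Data.Bool using (Bool; true; false)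
open import Data.List using (length)
open import Data.List.Properties using (length-++)
open import Data.List.Relation.Unary.Any using (here; there)
open import Data.List.Membership.Propositional using (_∈_)
open import Data.List.Membership.Propositional.Properties using (∈-map⁺; ∈-map⁻; ∈-++⁺ʳ)
open import Data.Product using (_,_; proj₁; proj₂)
open import Data.Sum using (inj₁; inj₂)
open import Data.Empty using (⊥-elim)
open import Relation.Nullary using (¬_; contradiction)
open import Relation.Binary.PropositionalEquality using (refl; sym; trans; cong; subst; module ≡-Reasoning)
open import Relation.Binary.Construct.Closure.ReflexiveTransitive using (ε; _◅_; _◅◅_)
open import Relation.Binary.Construct.Closure.Symmetric using (fwd; bwd)
import Relation.Binary.Construct.Closure.Equivalence as EqClosure
open import Function.Bundles using (mk⇔)

Arc : ℕ → Set
Arc m = Fin m × Bool × Fin m × Bool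

Point : ℕ → Set
Point m = Fin m × Bool

module _ {m : ℕ} {arcs : List (Arc m)} where

  flipC : ∀ {x y} → SameComponent arcs x y → SameComponent arcs y x
  flipC = EqClosure.symmetric (Joined arcs)

  edge : ∀ {x y} → Joined arcs x y → SameComponent arcs x y
  edge j = fwd j ◅ ε

  edgeBack : ∀ {x y} → Joined arcs y x → SameComponent arcs x y
  edgeBack j = bwd j ◅ ε

Invariant : ∀ {m} {X : Set} → List (Arc m) → (Point m → X) → Set
Invariant arcs f = ∀ {x y} → Joined arcs x y → f x ≡ f y

invariant-const : ∀ {m} {X : Set} {arcs : List (Arc m)} (f : Point m → X) → Invariant arcs f →
  ∀ {x y} → SameComponent arcs x y → f x ≡ f y
invariant-const f inv ε = refl
invariant-const f inv (fwd j ◅ p) = trans (inv j) (invariant-const f inv p)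
invariant-const f inv (bwd j ◅ p) = trans (sym (inv j)) (invariant-const f inv p)

connected⇒¬two : ∀ {m} {arcs : List (Arc m)} (r : Point m) →
  (∀ x → SameComponent arcs x r) → ¬ TwoComponents arcs
connected⇒¬two r reach (u , v , u≁v , _) = u≁v (reach u ◅◅ flipC (reach v))

separated⇒¬two : ∀ {m} {arcs : List (Arc m)} (x₁ x₂ x₃ : Point m) →
  ¬ SameComponent arcs x₁ x₂ → ¬ SameComponent arcs x₁ x₃ → ¬ SameComponent arcs x₂ x₃ →
  ¬ TwoComponents arcs
separated⇒¬two x₁ x₂ x₃ n₁₂ n₁₃ n₂₃ (u , v , _ , cover) with cover x₁ | cover x₂ | cover x₃
... | inj₁ a | inj₁ b | _      = n₁₂ (a ◅◅ flipC b)
... | inj₂ a | inj₂ b | _      = n₁₂ (a ◅◅ flipC b)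
... | inj₁ a | _      | inj₁ c = n₁₃ (a ◅◅ flipC c)
... | inj₂ a | _      | inj₂ c = n₁₃ (a ◅◅ flipC c)
... | _      | inj₁ b | inj₁ c = n₂₃ (b ◅◅ flipC c)
... | _      | inj₂ b | inj₂ c = n₂₃ (b ◅◅ flipC c)

threeValues⇒¬two : ∀ {m} {arcs : List (Arc m)} (f : Point m → ℕ) → Invariant arcs f →
  ∀ {x y z} → f x ≡ 0 → f y ≡ 1 → f z ≡ 2 → ¬ TwoComponents arcs
threeValues⇒¬two {arcs = arcs} f inv {x} {y} {z} fx fy fz =
  separated⇒¬two x y z (apart fx fy λ ()) (apart fx fz λ ()) (apart fy fz λ ())
  where
  apart : ∀ {a b i j} → f a ≡ i → f b ≡ j → ¬ i ≡ j → ¬ SameComponent arcs a b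
  apart fa fb i≢j a∼b = i≢j (trans (sym fa) (trans (invariant-const f inv a∼b) fb))

twoComponents : ∀ {m} {X : Set} {arcs : List (Arc m)} (f : Point m → X) → Invariant arcs f →
  ∀ u v → ¬ f u ≡ f v → (∀ x → SameComponent arcs x u ⊎ SameComponent arcs x v) →
  TwoComponents arcs
twoComponents f inv u v fu≢fv cover = u , v , (λ u∼v → fu≢fv (invariant-const f inv u∼v)) , cover

aCount : Split → ℕ
aCount A = 1
aCount B = 0

countA : Word → ℕ
countA [] = 0
countA (s ∷ w) = aCount s + countA w

level : (w : Word) → Fin (suc (length w)) → ℕ
level w zero = 0
level (s ∷ w) (suc i) = aCount s + level w i

end : (w : Word) → Fin (suc (length w))
end w = fromℕ (length w)

level-end : ∀ w → level w (end w) ≡ countA w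
level-end [] = refl
level-end (s ∷ w) = cong (aCount s +_) (level-end w)

level-≤ : ∀ w i → level w i ≤ countA w
level-≤ w zero = z≤n
level-≤ (A ∷ w) (suc i) = s≤s (level-≤ w i)
level-≤ (B ∷ w) (suc i) = level-≤ w i

level-onto : ∀ w c → c ≤ countA w → ∃[ i ] level w i ≡ c
level-onto w zero _ = zero , refl
level-onto (A ∷ w) (suc c) (s≤s c≤) with level-onto w c c≤
... | i , e = suc i , cong suc e
level-onto (B ∷ w) (suc c) c≤ with level-onto w (suc c) c≤
... | i , e = suc i , e

level-invariant : ∀ w {i s j t} → (i , s , j , t) ∈ twistArcs w → level w i ≡ level w j
level-invariant (A ∷ w) (here refl) = refl
level-invariant (A ∷ w) (there (here refl)) = refl
level-invariant (A ∷ w) (there (there a)) with ∈-map⁻ liftArc a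
... | _ , a′ , refl = cong suc (level-invariant w a′)
level-invariant (B ∷ w) (here refl) = refl
level-invariant (B ∷ w) (there (here refl)) = refl
level-invariant (B ∷ w) (there (there a)) with ∈-map⁻ liftArc a
... | _ , a′ , refl = level-invariant w a′

-- B-splits never join the top strand to the bottom one.
side-invariant : ∀ w → countA w ≡ 0 → ∀ {i s j t} → (i , s , j , t) ∈ twistArcs w → s ≡ t
side-invariant (A ∷ w) ()
side-invariant (B ∷ w) _ (here refl) = refl
side-invariant (B ∷ w) _ (there (here refl)) = refl
side-invariant (B ∷ w) noA (there (there a)) with ∈-map⁻ liftArc a
... | _ , a′ , refl = side-invariant w noA a′

ST : (w : Word) → Seg (length w) → Seg (length w) → Set
ST w = SameComponent (twistArcs w)

shift : ∀ {m} → Point m → Point (suc m)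
shift (i , b) = (suc i , b)

shiftComponent : ∀ s w {x y} → ST w x y → ST (s ∷ w) (shift x) (shift y)
shiftComponent s w =
  EqClosure.gmap shift (λ a → ∈-++⁺ʳ (splitArcs s zero (suc zero)) (∈-map⁺ liftArc a))

alongB : ∀ w b → Joined (twistArcs (B ∷ w)) (zero , b) (suc zero , b)
alongB w true = here refl
alongB w false = there (here refl)

toStart : ∀ w i b → level w i ≡ 0 → ST w (i , b) (zero , b)
toStart w zero b _ = ε
toStart (A ∷ w) (suc i) b ()
toStart (B ∷ w) (suc i) b e = shiftComponent B w (toStart w i b e) ◅◅ edgeBack (alongB w b)

sameLevel : ∀ w i j b → level w i ≡ level w j → ST w (i , b) (j , b)
sameLevel w zero zero b _ = ε
sameLevel w zero (suc j) b e = flipC (toStart w (suc j) b (sym e))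
sameLevel w (suc i) zero b e = toStart w (suc i) b e
sameLevel (A ∷ w) (suc i) (suc j) b e = shiftComponent A w (sameLevel w i j b (suc-injective e))
sameLevel (B ∷ w) (suc i) (suc j) b e = shiftComponent B w (sameLevel w i j b e)

-- The A-split creating level c + 1 joins the two sides at that level.
crossingAt : ∀ w c → suc c ≤ countA w → ∃[ j ] (level w j ≡ suc c × ST w (j , true) (j , false))
crossingAt (A ∷ w) zero _ = suc zero , refl , edge (there (here refl))
crossingAt (A ∷ w) (suc c) (s≤s c<) with crossingAt w c c<
... | j , e , p = suc j , cong suc e , shiftComponent A w p
crossingAt (B ∷ w) c c< with crossingAt w c c<
... | j , e , p = suc j , e , shiftComponent B w p

toTop : ∀ w i b → 1 ≤ level w i → ST w (i , b) (i , true)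
toTop w i true _ = ε
toTop w i false pos with level w i in eq | level-≤ w i
toTop w i false () | zero | _
... | suc c | bound with crossingAt w c bound
... | j , e , p =
  sameLevel w i j false (trans eq (sym e)) ◅◅ flipC p ◅◅ sameLevel w j i true (trans e (sym eq))

SF : (w : Word) → Seg (length w) → Seg (length w) → Set
SF w = SameComponent (foilArcs w)

-- Closing R_n up only adds arcs, so its components survive in F_n and T_n.
twist⊆foil : ∀ w {x y} → ST w x y → SF w x y
twist⊆foil w = EqClosure.map (λ a → there (there a))

foilClosure : ∀ w b → Joined (foilArcs w) (zero , b) (end w , b)
foilClosure w true = here refl
foilClosure w false = there (here refl)

endLevel≡0 : ∀ w a → countA w ≡ suc a → level w (end w) % suc a ≡ 0
endLevel≡0 w a e = trans (cong (_% suc a) (trans (level-end w) e)) (n%n≡0 (suc a))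

-- The foil closure identifies level 0 with level countA w = suc a, so levels
-- are invariant modulo suc a.
foilLevelInvariant : ∀ w a → countA w ≡ suc a → Invariant (foilArcs w) (λ x → level w (proj₁ x) % suc a)
foilLevelInvariant w a e (here refl) = sym (endLevel≡0 w a e)
foilLevelInvariant w a e (there (here refl)) = sym (endLevel≡0 w a e)
foilLevelInvariant w a e (there (there j)) = cong (_% suc a) (level-invariant w j)

foilSideInvariant : ∀ w → countA w ≡ 0 → Invariant (foilArcs w) proj₂
foilSideInvariant w _ (here refl) = refl
foilSideInvariant w _ (there (here refl)) = refl
foilSideInvariant w noA (there (there a)) = side-invariant w noA a

-- With an A-split the two sides meet at the right end, which the closure
-- joins to the left end: levels 0 and countA w form a single component.
endToHub : ∀ w b → 1 ≤ countA w → SF w (end w , b) (zero , true)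
endToHub w b pos = twist⊆foil w (toTop w (end w) b (subst (1 ≤_) (sym (level-end w)) pos))
                   ◅◅ edgeBack (foilClosure w true)

toFoilHub : ∀ w i b → 1 ≤ countA w → level w i ≡ 0 ⊎ level w i ≡ countA w →
  SF w (i , b) (zero , true)
toFoilHub w i b pos (inj₁ e) =
  twist⊆foil w (toStart w i b e) ◅◅ edge (foilClosure w b) ◅◅ endToHub w b pos
toFoilHub w i b pos (inj₂ e) =
  twist⊆foil w (sameLevel w i (end w) b (trans e (sym (level-end w)))) ◅◅ endToHub w b pos

foilTwo⇒ : ∀ w → TwoComponents (foilArcs w) → countA w ≡ 0 ⊎ countA w ≡ 2
foilTwo⇒ w two with countA w in a≡
... | 0 = inj₁ refl
... | 2 = inj₂ refl
... | 1 = ⊥-elim (connected⇒¬two (zero , true) hub two)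
  where
  pos : 1 ≤ countA w
  pos = subst (1 ≤_) (sym a≡) (s≤s z≤n)
  hub : ∀ x → SF w x (zero , true)
  hub (i , b) with level w i in e | subst (level w i ≤_) a≡ (level-≤ w i)
  ... | 0 | _ = toFoilHub w i b pos (inj₁ e)
  ... | 1 | _ = toFoilHub w i b pos (inj₂ (trans e (sym a≡)))
  ... | suc (suc _) | s≤s ()
... | suc (suc (suc a)) with level-onto w 1 (subst (1 ≤_) (sym a≡) (s≤s z≤n))
                           | level-onto w 2 (subst (2 ≤_) (sym a≡) (s≤s (s≤s z≤n)))
... | i₁ , e₁ | i₂ , e₂ =
  ⊥-elim (threeValues⇒¬two _ (foilLevelInvariant w (suc (suc a)) a≡)
            {zero , true} {i₁ , true} {i₂ , true} refl (cong (_% _) e₁) (cong (_% _) e₂) two)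

foilTwo⇐ : ∀ w → countA w ≡ 0 ⊎ countA w ≡ 2 → TwoComponents (foilArcs w)
foilTwo⇐ w (inj₁ noA) =
  twoComponents proj₂ (foilSideInvariant w noA) (zero , true) (zero , false) (λ ()) cover
  where
  flat : ∀ i → level w i ≡ 0
  flat i = n≤0⇒n≡0 (subst (level w i ≤_) noA (level-≤ w i))
  cover : ∀ x → SF w x (zero , true) ⊎ SF w x (zero , false)
  cover (i , true) = inj₁ (twist⊆foil w (toStart w i true (flat i)))
  cover (i , false) = inj₂ (twist⊆foil w (toStart w i false (flat i)))
foilTwo⇐ w (inj₂ twoA) with level-onto w 1 (subst (1 ≤_) (sym twoA) (s≤s z≤n))
... | j , e =
  twoComponents _ (foilLevelInvariant w 1 twoA) (zero , true) (j , true)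
    (λ p → contradiction (trans p (cong (_% 2) e)) λ ()) cover
  where
  pos : 1 ≤ countA w
  pos = subst (1 ≤_) (sym twoA) (s≤s z≤n)
  cover : ∀ x → SF w x (zero , true) ⊎ SF w x (j , true)
  cover (i , b) with level w i in eᵢ | subst (level w i ≤_) twoA (level-≤ w i)
  ... | 0 | _ = inj₁ (toFoilHub w i b pos (inj₁ eᵢ))
  ... | 2 | _ = inj₁ (toFoilHub w i b pos (inj₂ (trans eᵢ (sym twoA))))
  ... | suc (suc (suc _)) | s≤s (s≤s ())
  ... | 1 | _ = inj₂ (twist⊆foil w
                  (toTop w i b (subst (1 ≤_) (sym eᵢ) (s≤s z≤n)) ◅◅ sameLevel w i j true (trans eᵢ (sym e))))

SL : (w : Word) → Seg (length w) → Seg (length w) → Set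
SL w = SameComponent (loopArcs w)

twist⊆loop : ∀ w {x y} → ST w x y → SL w x y
twist⊆loop w = EqClosure.map (λ a → there (there a))

-- The loop closure joins the two sides at both ends, so levels stay invariant.
loopLevelInvariant : ∀ w → Invariant (loopArcs w) (λ x → level w (proj₁ x))
loopLevelInvariant w (here refl) = refl
loopLevelInvariant w (there (here refl)) = refl
loopLevelInvariant w (there (there a)) = level-invariant w a

leftToTop : ∀ w b → SL w (zero , b) (zero , true)
leftToTop w true = ε
leftToTop w false = edgeBack (here refl)

rightToTop : ∀ w b → SL w (end w , b) (end w , true)
rightToTop w true = ε
rightToTop w false = edgeBack (there (here refl))

toLeft : ∀ w i b → level w i ≡ 0 → SL w (i , b) (zero , true)
toLeft w i b e = twist⊆loop w (toStart w i b e) ◅◅ leftToTop w b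

loopTwo⇒ : ∀ w → TwoComponents (loopArcs w) → countA w ≡ 1
loopTwo⇒ w two with countA w in a≡
... | 1 = refl
... | 0 = ⊥-elim (connected⇒¬two (zero , true) reach two)
  where
  reach : ∀ x → SL w x (zero , true)
  reach (i , b) = toLeft w i b (n≤0⇒n≡0 (subst (level w i ≤_) a≡ (level-≤ w i)))
... | suc (suc a) with level-onto w 1 (subst (1 ≤_) (sym a≡) (s≤s z≤n))
                     | level-onto w 2 (subst (2 ≤_) (sym a≡) (s≤s (s≤s z≤n)))
... | i₁ , e₁ | i₂ , e₂ =
  ⊥-elim (threeValues⇒¬two _ (loopLevelInvariant w) {zero , true} {i₁ , true} {i₂ , true} refl e₁ e₂ two)

loopTwo⇐ : ∀ w → countA w ≡ 1 → TwoComponents (loopArcs w)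
loopTwo⇐ w oneA =
  twoComponents _ (loopLevelInvariant w) (zero , true) (end w , true)
    (λ p → contradiction (trans p (trans (level-end w) oneA)) λ ()) cover
  where
  cover : ∀ x → SL w x (zero , true) ⊎ SL w x (end w , true)
  cover (i , b) with level w i in e | subst (level w i ≤_) oneA (level-≤ w i)
  ... | 0 | _ = inj₁ (toLeft w i b e)
  ... | 1 | _ = inj₂ (twist⊆loop w (sameLevel w i (end w) b (trans e (sym (trans (level-end w) oneA))))
                      ◅◅ rightToTop w b)
  ... | suc (suc _) | s≤s ()


countA-++ : ∀ u v → countA (u ++ v) ≡ countA u + countA v
countA-++ [] v = refl
countA-++ (s ∷ u) v = trans (cong (aCount s +_) (countA-++ u v)) (sym (+-assoc (aCount s) (countA u) (countA v)))

countA-B^ : ∀ r → countA (B ^ r) ≡ 0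
countA-B^ zero = refl
countA-B^ (suc r) = countA-B^ r

length-B^ : ∀ r → length (B ^ r) ≡ r
length-B^ zero = refl
length-B^ (suc r) = cong suc (length-B^ r)

twoAWord : ℕ → ℕ → ℕ → Word
twoAWord p k r = (B ^ p) ++ A ∷ (B ^ k) ++ A ∷ (B ^ r)

countA-twoAWord : ∀ p k r → countA (twoAWord p k r) ≡ 2
countA-twoAWord p k r
  rewrite countA-++ (B ^ p) (A ∷ (B ^ k) ++ A ∷ (B ^ r)) | countA-++ (B ^ k) (A ∷ (B ^ r))
        | countA-B^ p | countA-B^ k | countA-B^ r = refl

length-twoAWord : ∀ p k r → length (twoAWord p k r) ≡ 2 + (p + (k + r))
length-twoAWord p k r
  rewrite length-++ (B ^ p) {A ∷ (B ^ k) ++ A ∷ (B ^ r)} | length-++ (B ^ k) {A ∷ (B ^ r)}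
        | length-B^ p | length-B^ k | length-B^ r = begin
  p + suc (k + suc r)        ≡⟨ cong (λ l → p + suc l) (+-suc k r) ⟩
  p + suc (suc (k + r))      ≡⟨ +-suc p (suc (k + r)) ⟩
  suc (p + suc (k + r))      ≡⟨ cong suc (+-suc p (k + r)) ⟩
  2 + (p + (k + r))          ∎
  where open ≡-Reasoning

noA⇒B^ : ∀ w → countA w ≡ 0 → w ≡ B ^ length w
noA⇒B^ [] _ = refl
noA⇒B^ (A ∷ w) ()
noA⇒B^ (B ∷ w) e = cong (B ∷_) (noA⇒B^ w e)

oneA⇒shape : ∀ w → countA w ≡ 1 → ∃[ k ] ∃[ r ] w ≡ (B ^ k) ++ A ∷ (B ^ r)
oneA⇒shape (A ∷ w) e = 0 , length w , cong (A ∷_) (noA⇒B^ w (suc-injective e))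
oneA⇒shape (B ∷ w) e with oneA⇒shape w e
... | k , r , eq = suc k , r , cong (B ∷_) eq

twoA⇒shape : ∀ w → countA w ≡ 2 → ∃[ p ] ∃[ k ] ∃[ r ] w ≡ twoAWord p k r
twoA⇒shape (A ∷ w) e with oneA⇒shape w (suc-injective e)
... | k , r , eq = 0 , k , r , cong (A ∷_) eq
twoA⇒shape (B ∷ w) e with twoA⇒shape w e
... | p , k , r , eq = suc p , k , r , cong (B ∷_) eq

TwoAOfLength : ℕ → Word → Set
TwoAOfLength n w = ∃[ p ] ∃[ k ] (p ≤ n ∸ 2 × k ≤ n ∸ p ∸ 2
                     × w ≡ (B ^ p) ++ A ∷ (B ^ k) ++ A ∷ (B ^ (n ∸ p ∸ k ∸ 2)))

dropSummand : ∀ p x → 2 + (p + x) ∸ p ≡ 2 + x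
dropSummand zero x = refl
dropSummand (suc p) x = dropSummand p x

twoAWord⇒TwoAOfLength : ∀ n p k r → length (twoAWord p k r) ≡ n → TwoAOfLength n (twoAWord p k r)
twoAWord⇒TwoAOfLength n p k r len with trans (sym len) (length-twoAWord p k r)
... | refl = p , k , m≤m+n p (k + r) , k≤ , cong (twoAWord p k) (sym r≡)
  where
  n∸p : 2 + (p + (k + r)) ∸ p ≡ 2 + (k + r)
  n∸p = dropSummand p (k + r)
  k≤ : k ≤ 2 + (p + (k + r)) ∸ p ∸ 2
  k≤ = subst (λ l → k ≤ l ∸ 2) (sym n∸p) (m≤m+n k r)
  r≡ : 2 + (p + (k + r)) ∸ p ∸ k ∸ 2 ≡ r
  r≡ = trans (cong (λ l → l ∸ k ∸ 2) n∸p) (cong (_∸ 2) (dropSummand k r))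

TwoAOfLength⇒length : ∀ m p k → p ≤ m → k ≤ 2 + m ∸ p ∸ 2 →
  length (twoAWord p k (2 + m ∸ p ∸ k ∸ 2)) ≡ 2 + m
TwoAOfLength⇒length m p k p≤ k≤ = trans (length-twoAWord p k _) (cong (2 +_) total)
  where
  n∸p : 2 + m ∸ p ≡ 2 + (m ∸ p)
  n∸p = +-∸-assoc 2 p≤
  k≤′ : k ≤ m ∸ p
  k≤′ = subst (λ l → k ≤ l ∸ 2) n∸p k≤
  r≡ : 2 + m ∸ p ∸ k ∸ 2 ≡ m ∸ p ∸ k
  r≡ = trans (cong (λ l → l ∸ k ∸ 2) n∸p) (cong (_∸ 2) (+-∸-assoc 2 k≤′))
  total : p + (k + (2 + m ∸ p ∸ k ∸ 2)) ≡ m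
  total = trans (cong (λ r → p + (k + r)) r≡) (trans (cong (p +_) (m+[n∸m]≡n k≤′)) (m+[n∸m]≡n p≤))

𝓕-zero : ∀ w → 𝓕 0 w ⇔ w ≡ []
𝓕-zero w = mk⇔ (to w) λ { refl → refl , foilTwo⇐ [] (inj₁ refl) }
  where
  to : ∀ w → 𝓕 0 w → w ≡ []
  to [] _ = refl
  to (_ ∷ _) (() , _)

𝓕-one : ∀ w → 𝓕 1 w ⇔ w ≡ B ∷ []
𝓕-one w = mk⇔ (to w) λ { refl → refl , foilTwo⇐ (B ∷ []) (inj₁ refl) }
  where
  to : ∀ w → 𝓕 1 w → w ≡ B ∷ []
  to (B ∷ []) _ = refl
  to (A ∷ []) (_ , two) with foilTwo⇒ (A ∷ []) two
  ... | inj₁ ()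
  ... | inj₂ ()
  to [] (() , _)
  to (_ ∷ _ ∷ _) (() , _)

-- A prefix A raises the number of A-splits from 1 (loop) to 2 (foil);
-- a prefix B keeps it at 0 or 2.
𝓕-recursion : ∀ n → 2 ≤ n → ∀ w →
  𝓕 n w ⇔ ((∃[ v ] (w ≡ A ∷ v × 𝓣 (n ∸ 1) v)) ⊎ (∃[ v ] (w ≡ B ∷ v × 𝓕 (n ∸ 1) v)))
𝓕-recursion (suc (suc m)) (s≤s (s≤s z≤n)) w = mk⇔ (to w) from
  where
  to : ∀ w → 𝓕 (2 + m) w → (∃[ v ] (w ≡ A ∷ v × 𝓣 (suc m) v)) ⊎ (∃[ v ] (w ≡ B ∷ v × 𝓕 (suc m) v))
  to (A ∷ v) (len , two) with foilTwo⇒ (A ∷ v) two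
  ... | inj₂ twoA = inj₁ (v , refl , suc-injective len , loopTwo⇐ v (suc-injective twoA))
  to (B ∷ v) (len , two) = inj₂ (v , refl , suc-injective len , foilTwo⇐ v (foilTwo⇒ (B ∷ v) two))
  from : ∀ {w} → (∃[ v ] (w ≡ A ∷ v × 𝓣 (suc m) v)) ⊎ (∃[ v ] (w ≡ B ∷ v × 𝓕 (suc m) v)) → 𝓕 (2 + m) w
  from (inj₁ (v , refl , len , two)) = cong suc len , foilTwo⇐ (A ∷ v) (inj₂ (cong suc (loopTwo⇒ v two)))
  from (inj₂ (v , refl , len , two)) = cong suc len , foilTwo⇐ (B ∷ v) (foilTwo⇒ v two)

𝓕-explicit : ∀ n → 2 ≤ n → ∀ w → 𝓕 n w ⇔ (TwoAOfLength n w ⊎ w ≡ B ^ n)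
𝓕-explicit (suc (suc m)) (s≤s (s≤s z≤n)) w = mk⇔ to from
  where
  to : 𝓕 (2 + m) w → TwoAOfLength (2 + m) w ⊎ w ≡ B ^ (2 + m)
  to (len , two) with foilTwo⇒ w two
  ... | inj₁ noA = inj₂ (trans (noA⇒B^ w noA) (cong (B ^_) len))
  ... | inj₂ twoA with twoA⇒shape w twoA
  ...   | p , k , r , refl = inj₁ (twoAWord⇒TwoAOfLength _ p k r len)
  from : ∀ {w} → TwoAOfLength (2 + m) w ⊎ w ≡ B ^ (2 + m) → 𝓕 (2 + m) w
  from (inj₁ (p , k , p≤ , k≤ , refl)) =
    TwoAOfLength⇒length m p k p≤ k≤ , foilTwo⇐ (twoAWord p k r) (inj₂ (countA-twoAWord p k r))
    where
    r : ℕ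
    r = 2 + m ∸ p ∸ k ∸ 2
  from (inj₂ refl) = length-B^ (2 + m) , foilTwo⇐ (B ^ (2 + m)) (inj₁ (countA-B^ (2 + m)))

mainTheorem13 : (∀ w → 𝓕 0 w ⇔ w ≡ [])
    × (∀ w → 𝓕 1 w ⇔ w ≡ B ∷ [])
    × (∀ n → 2 ≤ n → ∀ w →
    𝓕 n w ⇔ ((∃[ v ] (w ≡ A ∷ v × 𝓣 (n ∸ 1) v)) ⊎ (∃[ v ] (w ≡ B ∷ v × 𝓕 (n ∸ 1) v))))
    × (∀ n → 2 ≤ n → ∀ w →
    𝓕 n w ⇔ ((∃[ p ] ∃[ k ] (p ≤ n ∸ 2 × k ≤ n ∸ p ∸ 2
    × w ≡ (B ^ p) ++ A ∷ (B ^ k) ++ A ∷ (B ^ (n ∸ p ∸ k ∸ 2))))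
    ⊎ w ≡ B ^ n))
mainTheorem13 = 𝓕-zero , 𝓕-one , 𝓕-recursion , 𝓕-explicit
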